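{- Let $G$ be a simple connected graph of order $n\geq 3$, and let $V=V(G)\subseteq V(R(G))$. If $D$ is a differential set of $R(G)$, then $V$ contains a differential set $S$ of $R(G)$ such that $|S|=|D|$.
   Context: $R(G)$ is the graph obtained from $G$ by adding, for each edge $e=xy\in E(G)$, a new vertex $v_e$ adjacent exactly to $x$ and $y$. For a graph $H$ and $S\subseteq V(H)$, $B_H(S)$ is the set of vertices not in $S$ adjacent to some vertex of $S$, $\partial_H(S)=|B_H(S)|-|S|$, $\partial(H)=\max_{S\subseteq V(H)}\partial_H(S)$, and $S$ is a differential set of $H$ if $\partial_H(S)=\partial(H)$. -}

module Defs where

open import Data.Bool using (Bool; true; false; _∧_; _∨_; not; T)
open import Data.Nat as ℕ using (ℕ)
open import Data.Fin as Fin using (Fin; splitAt; _↑ˡ_; _↑ʳ_)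
open import Data.Fin.Subset using (Subset; ∣_∣; _∈_; _⊆_)
open import Data.Integer as ℤ using (ℤ; +_; _-_)
open import Data.List as List using (List; []; _∷_; cartesianProduct; filterᵇ; allFin; length; lookup)
open import Data.Bool.ListAction using (any)
open import Data.Vec as Vec using (Vec; tabulate)
open import Data.Product using (_×_; _,_; proj₁; proj₂)
open import Data.Sum using (inj₁; inj₂)
open import Relation.Binary.PropositionalEquality using (_≡_)
open import Relation.Nullary using (¬_)
open import Relation.Nullary.Decidable using (⌊_⌋)

record SimpleGraph (n : ℕ) : Set where
  field
    adj     : Fin n → Fin n → Bool
    symm    : ∀ x y → adj x y ≡ adj y x
    irrefl  : ∀ x → adj x x ≡ false
open SimpleGraph public

data Walk {n : ℕ} (G : SimpleGraph n) : Fin n → Fin n → Set where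
  nil  : ∀ {u} → Walk G u u
  cons : ∀ {u w v} → T (adj G u w) → Walk G w v → Walk G u v

Connected : ∀ {n} → SimpleGraph n → Set
Connected {n} G = (u v : Fin n) → Walk G u v

boundary : ∀ {N} → (Fin N → Fin N → Bool) → Subset N → Subset N
boundary {N} a S = tabulate λ v →
  not (Vec.lookup S v) ∧ any (λ u → Vec.lookup S u ∧ a u v) (allFin N)

∂ : ∀ {N} → (Fin N → Fin N → Bool) → Subset N → ℤ
∂ a S = + ∣ boundary a S ∣ - + ∣ S ∣

IsDifferential : ∀ {N} → (Fin N → Fin N → Bool) → Subset N → Set
IsDifferential a S = ∀ T → ∂ a T ℤ.≤ ∂ a S

edges : ∀ {n} → SimpleGraph n → List (Fin n × Fin n)
edges {n} G = filterᵇ (λ p → ⌊ proj₁ p Fin.<? proj₂ p ⌋ ∧ adj G (proj₁ p) (proj₂ p))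
                      (cartesianProduct (allFin n) (allFin n))

numEdges : ∀ {n} → SimpleGraph n → ℕ
numEdges G = length (edges G)

-- Vertex set of R(G): Fin (n + m); the first n are the original
-- vertices (x ↑ˡ m), the last m are the edge vertices v_e (n ↑ʳ e).
RV : ∀ {n} → SimpleGraph n → ℕ
RV {n} G = n ℕ.+ numEdges G

endpoint : ∀ {n} (G : SimpleGraph n) → Fin n → Fin (numEdges G) → Bool
endpoint G x e with lookup (edges G) e
... | (a , b) = ⌊ x Fin.≟ a ⌋ ∨ ⌊ x Fin.≟ b ⌋

Radj : ∀ {n} (G : SimpleGraph n) → Fin (RV G) → Fin (RV G) → Bool
Radj {n} G i j with splitAt n i | splitAt n j
... | inj₁ x | inj₁ y = adj G x y
... | inj₁ x | inj₂ e = endpoint G x e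
... | inj₂ e | inj₁ y = endpoint G y e
... | inj₂ _ | inj₂ _ = false

Vset : ∀ {n} (G : SimpleGraph n) → Subset (RV G)
Vset {n} G = tabulate λ i → isOrig (splitAt n i)
  where
  isOrig : _ → Bool
  isOrig (inj₁ _) = true
  isOrig (inj₂ _) = false

-- Let D be a differential set of R(G) containing an edge vertex v_e, e = xy.
-- The endpoints x and y cannot both lie in D: then every neighbour of v_e is
-- in D, so removing v_e from D keeps the whole boundary while shrinking D,
-- which would increase the differential.  So some endpoint, say x, is not in
-- D, and we exchange v_e for x.  The size is unchanged and the boundary does
-- not shrink: x dominates y, the only other neighbour of v_e, and v_e itself
-- enters the boundary in place of x.  Each exchange lowers the number of edge
-- vertices in D, so iterating ends with a differential set inside V.
module Submission where

open import Defs
open import Data.Nat using (ℕ; _≥_)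
open import Data.Fin.Subset using (Subset; ∣_∣; _⊆_)
open import Data.Product using (Σ; _×_)
open import Relation.Binary.PropositionalEquality using (_≡_)

open import Data.Bool using (Bool; true; false; not; T; _∧_)
open import Data.Bool.Properties using (T-∧; T-∨; T-≡)
open import Data.Empty using (⊥-elim)
open import Data.Fin using (Fin; zero; _<?_; splitAt; _↑ˡ_; _↑ʳ_; _≟_)
open import Data.Fin.Properties using (splitAt-↑ˡ; splitAt-↑ʳ; splitAt⁻¹-↑ˡ; splitAt⁻¹-↑ʳ)
open import Data.Fin.Subset using (inside; outside; _∈_; _∉_; _─_; _-_; _∪_; _∩_; ∁; ⁅_⁆)
open import Data.Fin.Subset.Properties
  using (_∈?_; nonempty?; drop-there; p─⊥≡p; p─q⊆p; x∈p∧x≢y⇒x∈p-y;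
         x∈p∪q⁺; x∈p∪q⁻; x∈p∩q⁺; x∈p∩q⁻; x∈⁅x⁆; x∈⁅y⁆⇒x≡y; x∉⁅y⁆⇒x≢y;
         x∈p⇒x∉∁p; x∉p⇒x∈∁p; x∈∁p⇒x∉p; x∉∁p⇒x∈p; ⊆-antisym; p⊆q⇒∣p∣≤∣q∣; x∈p⇒∣p-x∣<∣p∣)
open import Data.Integer as ℤ using (_⊖_)
import Data.Integer.Properties as ℤ
open import Data.List as List using (allFin)
open import Data.List.Membership.Propositional using (lose)
open import Data.List.Membership.Propositional.Properties using (∈-allFin; ∈-lookup; ∈-filter⁻)
open import Data.List.Relation.Unary.Any using (satisfied)
open import Data.List.Relation.Unary.Any.Properties using (any⁺; any⁻)
open import Data.Nat using (suc; _≤_; _<_; s≤s)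
open import Data.Nat.Induction using (<-wellFounded)
import Data.Nat.Properties as ℕ
open import Data.Product using (∃-syntax; Σ-syntax; _,_; proj₁; proj₂)
import Data.Product as Product
open import Data.Sum using (_⊎_; inj₁; inj₂; [_,_]′)
import Data.Sum as Sum
open import Data.Vec using (_∷_; here; there; tabulate; lookup)
open import Data.Vec.Properties using (lookup∘tabulate; []=⇒lookup; lookup⇒[]=)
open import Function using (_∘_; id; const)
open import Function.Bundles using (Equivalence)
open import Induction.WellFounded using (Acc; acc)
open import Relation.Binary.PropositionalEquality using (refl; sym; trans; cong; subst; _≢_; module ≡-Reasoning)
open import Relation.Nullary using (¬_; yes; no)
open import Relation.Nullary.Decidable using (⌊_⌋; T?; toWitness; fromWitness)

open Equivalence using (to; from)

x∈p─q⁻ : ∀ {n} {x : Fin n} (p q : Subset n) → x ∈ p ─ q → x ∈ p × x ∉ q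
x∈p─q⁻            (inside  ∷ p) (outside ∷ q) here          = here , λ ()
x∈p─q⁻ {x = zero} (outside ∷ p) (outside ∷ q) ()
x∈p─q⁻ {x = zero} (outside ∷ p) (inside  ∷ q) ()
x∈p─q⁻            (_       ∷ p) (_       ∷ q) (there x∈p─q) =
  Product.map there (λ x∉q → x∉q ∘ drop-there) (x∈p─q⁻ p q x∈p─q)

x∈p-y⁻ : ∀ {n} {x y : Fin n} {p : Subset n} → x ∈ p - y → x ∈ p × x ≢ y
x∈p-y⁻ {p = p} x∈p-y = Product.map₂ x∉⁅y⁆⇒x≢y (x∈p─q⁻ p _ x∈p-y)

∣p∣≡1+∣p-x∣ : ∀ {n} {x : Fin n} {p : Subset n} → x ∈ p → ∣ p ∣ ≡ suc ∣ p - x ∣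
∣p∣≡1+∣p-x∣ {p = inside  ∷ p} here        = cong (suc ∘ ∣_∣) (sym (p─⊥≡p p))
∣p∣≡1+∣p-x∣ {p = inside  ∷ p} (there x∈p) = cong suc (∣p∣≡1+∣p-x∣ x∈p)
∣p∣≡1+∣p-x∣ {p = outside ∷ p} (there x∈p) = ∣p∣≡1+∣p-x∣ x∈p

∣p∣≤1+∣p-x∣ : ∀ {n} (p : Subset n) x → ∣ p ∣ ≤ suc ∣ p - x ∣
∣p∣≤1+∣p-x∣ p x with x ∈? p
... | yes x∈p = ℕ.≤-reflexive (∣p∣≡1+∣p-x∣ x∈p)
... | no  x∉p = ℕ.m≤n⇒m≤1+n (p⊆q⇒∣p∣≤∣q∣ {p = p} {q = p - x} λ y∈p →
                  x∈p∧x≢y⇒x∈p-y y∈p λ { refl → x∉p y∈p })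

replace : ∀ {n} → Subset n → Fin n → Fin n → Subset n
replace p v x = (p - v) ∪ ⁅ x ⁆

module _ {n : ℕ} {p : Subset n} {v x : Fin n} where

  x∈replace : x ∈ replace p v x
  x∈replace = x∈p∪q⁺ (inj₂ (x∈⁅x⁆ x))

  ∈-replace⁺ : ∀ {w} → w ∈ p → w ≢ v → w ∈ replace p v x
  ∈-replace⁺ w∈p w≢v = x∈p∪q⁺ (inj₁ (x∈p∧x≢y⇒x∈p-y w∈p w≢v))

  ∈-replace⁻ : ∀ {w} → w ∈ replace p v x → (w ∈ p × w ≢ v) ⊎ w ≡ x
  ∈-replace⁻ w∈r = Sum.map x∈p-y⁻ (x∈⁅y⁆⇒x≡y x) (x∈p∪q⁻ (p - v) ⁅ x ⁆ w∈r)

  ∉-replace : ∀ {w} → w ∉ p → w ≢ x → w ∉ replace p v x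
  ∉-replace w∉p w≢x w∈r = [ w∉p ∘ proj₁ , w≢x ]′ (∈-replace⁻ w∈r)

  v∉replace : x ≢ v → v ∉ replace p v x
  v∉replace x≢v v∈r = [ (λ (_ , v≢v) → v≢v refl) , x≢v ∘ sym ]′ (∈-replace⁻ v∈r)

  ∣replace∣≡∣p∣ : v ∈ p → x ∉ p → ∣ replace p v x ∣ ≡ ∣ p ∣
  ∣replace∣≡∣p∣ v∈p x∉p = begin
    ∣ replace p v x ∣         ≡⟨ ∣p∣≡1+∣p-x∣ x∈replace ⟩
    suc ∣ replace p v x - x ∣ ≡⟨ cong (suc ∘ ∣_∣) (⊆-antisym replace-x⊆p-v p-v⊆replace-x) ⟩
    suc ∣ p - v ∣             ≡⟨ sym (∣p∣≡1+∣p-x∣ v∈p) ⟩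
    ∣ p ∣                     ∎
    where
    open ≡-Reasoning
    replace-x⊆p-v : replace p v x - x ⊆ p - v
    replace-x⊆p-v w∈r-x with x∈p-y⁻ w∈r-x
    ... | w∈r , w≢x = [ Product.uncurry x∈p∧x≢y⇒x∈p-y , ⊥-elim ∘ w≢x ]′ (∈-replace⁻ w∈r)
    p-v⊆replace-x : p - v ⊆ replace p v x - x
    p-v⊆replace-x w∈p-v with x∈p-y⁻ w∈p-v
    ... | w∈p , w≢v = x∈p∧x≢y⇒x∈p-y (∈-replace⁺ w∈p w≢v) λ { refl → x∉p w∈p }

  ∣replace∩q∣<∣p∩q∣ : ∀ {q} → v ∈ p → v ∈ q → x ∉ q → ∣ replace p v x ∩ q ∣ < ∣ p ∩ q ∣
  ∣replace∩q∣<∣p∩q∣ {q} v∈p v∈q x∉q = begin-strict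
    ∣ replace p v x ∩ q ∣ ≤⟨ p⊆q⇒∣p∣≤∣q∣ replace∩q⊆p∩q-v ⟩
    ∣ p ∩ q - v ∣         <⟨ x∈p⇒∣p-x∣<∣p∣ (x∈p∩q⁺ (v∈p , v∈q)) ⟩
    ∣ p ∩ q ∣             ∎
    where
    open ℕ.≤-Reasoning
    replace∩q⊆p∩q-v : replace p v x ∩ q ⊆ p ∩ q - v
    replace∩q⊆p∩q-v w∈r∩q with x∈p∩q⁻ _ q w∈r∩q
    ... | w∈r , w∈q with ∈-replace⁻ w∈r
    ...   | inj₁ (w∈p , w≢v) = x∈p∧x≢y⇒x∈p-y (x∈p∩q⁺ (w∈p , w∈q)) w≢v
    ...   | inj₂ refl        = ⊥-elim (x∉q w∈q)

module _ {N : ℕ} {f : Fin N → Bool} {x : Fin N} where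

  ∈-tabulate⁺ : T (f x) → x ∈ tabulate f
  ∈-tabulate⁺ t = lookup⇒[]= x (tabulate f) (trans (lookup∘tabulate f x) (to T-≡ t))

  ∈-tabulate⁻ : x ∈ tabulate f → T (f x)
  ∈-tabulate⁻ x∈ = from T-≡ (trans (sym (lookup∘tabulate f x)) ([]=⇒lookup x∈))

module _ {N : ℕ} {p : Subset N} {x : Fin N} where

  ∈⇒T-lookup : x ∈ p → T (lookup p x)
  ∈⇒T-lookup x∈p = from T-≡ ([]=⇒lookup x∈p)

  T-lookup⇒∈ : T (lookup p x) → x ∈ p
  T-lookup⇒∈ t = lookup⇒[]= x p (to T-≡ t)

  ∉⇒T-not-lookup : x ∉ p → T (not (lookup p x))
  ∉⇒T-not-lookup x∉p with lookup p x in eq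
  ... | true  = x∉p (lookup⇒[]= x p eq)
  ... | false = _

  T-not-lookup⇒∉ : T (not (lookup p x)) → x ∉ p
  T-not-lookup⇒∉ t x∈p with lookup p x | []=⇒lookup x∈p
  T-not-lookup⇒∉ () x∈p | true | refl

module _ {N : ℕ} (a : Fin N → Fin N → Bool) where

  ∈-boundary⁺ : ∀ {S w} → w ∉ S → ∃[ u ] u ∈ S × T (a u w) → w ∈ boundary a S
  ∈-boundary⁺ w∉S (u , u∈S , auw) = ∈-tabulate⁺ (from T-∧
    (∉⇒T-not-lookup w∉S , any⁺ _ (lose (∈-allFin u) (from T-∧ (∈⇒T-lookup u∈S , auw)))))

  ∈-boundary⁻ : ∀ {S w} → w ∈ boundary a S → w ∉ S × ∃[ u ] u ∈ S × T (a u w)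
  ∈-boundary⁻ w∈B with to T-∧ (∈-tabulate⁻ w∈B)
  ... | w∉S , some-u with satisfied (any⁻ _ (allFin N) some-u)
  ...   | u , u∈S∧auw with to T-∧ u∈S∧auw
  ...     | u∈S , auw = T-not-lookup⇒∉ w∉S , u , T-lookup⇒∈ u∈S , auw

  ∂≡∣B∣⊖∣S∣ : ∀ S → ∂ a S ≡ ∣ boundary a S ∣ ⊖ ∣ S ∣
  ∂≡∣B∣⊖∣S∣ S = ℤ.[+m]-[+n]≡m⊖n ∣ boundary a S ∣ ∣ S ∣

  neighbourhood⊈differential : ∀ {D v} → IsDifferential a D → v ∈ D →
                               ¬ (∀ {w} → T (a v w) → w ∈ D)
  neighbourhood⊈differential {D} {v} D-diff v∈D N[v]⊆D = ℤ.<⇒≱ ∂D<∂[D-v] (D-diff (D - v))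
    where
    open ℤ.≤-Reasoning
    B⊆B[D-v] : boundary a D ⊆ boundary a (D - v)
    B⊆B[D-v] w∈B with ∈-boundary⁻ w∈B
    ... | w∉D , u , u∈D , auw =
      ∈-boundary⁺ (w∉D ∘ p─q⊆p D ⁅ v ⁆)
                  (u , x∈p∧x≢y⇒x∈p-y u∈D (λ { refl → w∉D (N[v]⊆D auw) }) , auw)
    ∂D<∂[D-v] : ∂ a D ℤ.< ∂ a (D - v)
    ∂D<∂[D-v] = begin-strict
      ∂ a D                                ≡⟨ ∂≡∣B∣⊖∣S∣ D ⟩
      ∣ boundary a D ∣ ⊖ ∣ D ∣             ≡⟨ cong (∣ boundary a D ∣ ⊖_) (∣p∣≡1+∣p-x∣ v∈D) ⟩
      ∣ boundary a D ∣ ⊖ suc ∣ D - v ∣     <⟨ ℤ.⊖-monoʳ->-< ∣ boundary a D ∣ (ℕ.n<1+n _) ⟩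
      ∣ boundary a D ∣ ⊖ ∣ D - v ∣         ≤⟨ ℤ.⊖-monoˡ-≤ ∣ D - v ∣ (p⊆q⇒∣p∣≤∣q∣ B⊆B[D-v]) ⟩
      ∣ boundary a (D - v) ∣ ⊖ ∣ D - v ∣   ≡⟨ ∂≡∣B∣⊖∣S∣ (D - v) ⟨
      ∂ a (D - v)                          ∎

  module _ {D : Subset N} {v x : Fin N} (v∈D : v ∈ D) (x∉D : x ∉ D) (axv : T (a x v))
           (N[v]⊆N[x] : ∀ {w} → T (a v w) → w ≡ x ⊎ T (a x w)) where

    private
      D′ = replace D v x

      x∈D′ : x ∈ D′
      x∈D′ = x∈replace

      v∉D′ : v ∉ D′
      v∉D′ = v∉replace λ { refl → x∉D v∈D }

      neighbour-in-replace : ∀ {u w} → u ∈ D → T (a u w) → w ≢ x → ∃[ u′ ] u′ ∈ D′ × T (a u′ w)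
      neighbour-in-replace {u} u∈D auw w≢x with u ≟ v
      ... | no u≢v   = u , ∈-replace⁺ u∈D u≢v , auw
      ... | yes refl = x , x∈D′ , [ ⊥-elim ∘ w≢x , id ]′ (N[v]⊆N[x] auw)

    boundary-replace : boundary a D - x ⊆ boundary a D′ - v
    boundary-replace w∈B-x with x∈p-y⁻ w∈B-x
    ... | w∈B , w≢x with ∈-boundary⁻ w∈B
    ...   | w∉D , u , u∈D , auw = x∈p∧x≢y⇒x∈p-y
            (∈-boundary⁺ (∉-replace w∉D w≢x) (neighbour-in-replace u∈D auw w≢x))
            (λ { refl → w∉D v∈D })

    ∣boundary∣≤∣boundary-replace∣ : ∣ boundary a D ∣ ≤ ∣ boundary a D′ ∣
    ∣boundary∣≤∣boundary-replace∣ = begin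
      ∣ boundary a D ∣           ≤⟨ ∣p∣≤1+∣p-x∣ (boundary a D) x ⟩
      suc ∣ boundary a D - x ∣   ≤⟨ s≤s (p⊆q⇒∣p∣≤∣q∣ boundary-replace) ⟩
      suc ∣ boundary a D′ - v ∣  ≡⟨ ∣p∣≡1+∣p-x∣ v∈B′ ⟨
      ∣ boundary a D′ ∣          ∎
      where
      open ℕ.≤-Reasoning
      v∈B′ : v ∈ boundary a D′
      v∈B′ = ∈-boundary⁺ v∉D′ (x , x∈D′ , axv)

    ∂-replace : ∂ a D ℤ.≤ ∂ a D′
    ∂-replace = begin
      ∂ a D                       ≡⟨ ∂≡∣B∣⊖∣S∣ D ⟩
      ∣ boundary a D ∣ ⊖ ∣ D ∣    ≤⟨ ℤ.⊖-monoˡ-≤ ∣ D ∣ ∣boundary∣≤∣boundary-replace∣ ⟩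
      ∣ boundary a D′ ∣ ⊖ ∣ D ∣   ≡⟨ cong (∣ boundary a D′ ∣ ⊖_) (∣replace∣≡∣p∣ v∈D x∉D) ⟨
      ∣ boundary a D′ ∣ ⊖ ∣ D′ ∣  ≡⟨ ∂≡∣B∣⊖∣S∣ D′ ⟨
      ∂ a D′                      ∎
      where open ℤ.≤-Reasoning

module _ {n : ℕ} (G : SimpleGraph n) where

  vertex : Fin n → Fin (RV G)
  vertex x = x ↑ˡ numEdges G

  edgeVertex : Fin (numEdges G) → Fin (RV G)
  edgeVertex e = n ↑ʳ e

  ends : Fin (numEdges G) → Fin n × Fin n
  ends e = List.lookup (edges G) e

  ends-adjacent : ∀ e → T (adj G (proj₁ (ends e)) (proj₂ (ends e)))
  ends-adjacent e = proj₂ (to T-∧ (proj₂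
    (∈-filter⁻ (T? ∘ isEdge) {xs = List.cartesianProduct (allFin n) (allFin n)} (∈-lookup e))))
    where
    isEdge : Fin n × Fin n → Bool
    isEdge p = ⌊ proj₁ p <? proj₂ p ⌋ ∧ adj G (proj₁ p) (proj₂ p)

  endpoint-proj₁ : ∀ e → T (endpoint G (proj₁ (ends e)) e)
  endpoint-proj₁ e with List.lookup (edges G) e
  ... | x , y = from (T-∨ {⌊ x ≟ x ⌋} {⌊ x ≟ y ⌋}) (inj₁ (fromWitness refl))

  endpoint-proj₂ : ∀ e → T (endpoint G (proj₂ (ends e)) e)
  endpoint-proj₂ e with List.lookup (edges G) e
  ... | x , y = from (T-∨ {⌊ y ≟ x ⌋} {⌊ y ≟ y ⌋}) (inj₂ (fromWitness refl))

  endpoint⁻ : ∀ e {z} → T (endpoint G z e) → z ≡ proj₁ (ends e) ⊎ z ≡ proj₂ (ends e)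
  endpoint⁻ e {z} t with List.lookup (edges G) e
  ... | x , y = Sum.map toWitness toWitness (to (T-∨ {⌊ z ≟ x ⌋} {⌊ z ≟ y ⌋}) t)

  Radj-vertex-vertex : ∀ x y → Radj G (vertex x) (vertex y) ≡ adj G x y
  Radj-vertex-vertex x y rewrite splitAt-↑ˡ n x (numEdges G) | splitAt-↑ˡ n y (numEdges G) = refl

  Radj-vertex-edgeVertex : ∀ x e → Radj G (vertex x) (edgeVertex e) ≡ endpoint G x e
  Radj-vertex-edgeVertex x e rewrite splitAt-↑ˡ n x (numEdges G) | splitAt-↑ʳ n (numEdges G) e = refl

  Radj-edgeVertex-vertex : ∀ e y → Radj G (edgeVertex e) (vertex y) ≡ endpoint G y e
  Radj-edgeVertex-vertex e y rewrite splitAt-↑ʳ n (numEdges G) e | splitAt-↑ˡ n y (numEdges G) = refl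

  Radj-edgeVertex-edgeVertex : ∀ e f → Radj G (edgeVertex e) (edgeVertex f) ≡ false
  Radj-edgeVertex-edgeVertex e f rewrite splitAt-↑ʳ n (numEdges G) e | splitAt-↑ʳ n (numEdges G) f = refl

  vertex-or-edgeVertex : ∀ i → (∃[ x ] i ≡ vertex x) ⊎ (∃[ e ] i ≡ edgeVertex e)
  vertex-or-edgeVertex i with splitAt n i in eq
  ... | inj₁ x = inj₁ (x , sym (splitAt⁻¹-↑ˡ eq))
  ... | inj₂ e = inj₂ (e , sym (splitAt⁻¹-↑ʳ eq))

  edgeVertex-neighbours : ∀ e {w} → T (Radj G (edgeVertex e) w) →
                          w ≡ vertex (proj₁ (ends e)) ⊎ w ≡ vertex (proj₂ (ends e))
  edgeVertex-neighbours e {w} t with vertex-or-edgeVertex w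
  ... | inj₁ (y , refl) = Sum.map (cong vertex) (cong vertex)
                            (endpoint⁻ e (subst T (Radj-edgeVertex-vertex e y) t))
  ... | inj₂ (f , refl) = ⊥-elim (subst T (Radj-edgeVertex-edgeVertex e f) t)

  private
    isLeft : ∀ {k l} → Fin k ⊎ Fin l → Bool
    isLeft = [ const true , const false ]′

    lookup-tabulated : ∀ {N} {f : Fin N → Bool} {v} → v ≡ tabulate f → ∀ i → lookup v i ≡ f i
    lookup-tabulated refl = lookup∘tabulate _

    -- Vset is tabulated from a where-bound function; unifying Vset G with tabulate f exposes it.
    lookup-Vset : ∀ i → lookup (Vset G) i ≡ isLeft (splitAt n i)
    lookup-Vset i with splitAt n i | lookup-tabulated {v = Vset G} refl i
    ... | inj₁ _ | eq = eq
    ... | inj₂ _ | eq = eq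

  vertex∈Vset : ∀ x → vertex x ∈ Vset G
  vertex∈Vset x = lookup⇒[]= (vertex x) (Vset G)
    (trans (lookup-Vset (vertex x)) (cong isLeft (splitAt-↑ˡ n x (numEdges G))))

  edgeVertex∉Vset : ∀ e → edgeVertex e ∉ Vset G
  edgeVertex∉Vset e e∈V with trans (sym ([]=⇒lookup e∈V)) (trans (lookup-Vset (edgeVertex e))
                                  (cong isLeft (splitAt-↑ʳ n (numEdges G) e)))
  ... | ()

  ∉Vset⇒edgeVertex : ∀ {i} → i ∉ Vset G → ∃[ e ] i ≡ edgeVertex e
  ∉Vset⇒edgeVertex {i} i∉V with vertex-or-edgeVertex i
  ... | inj₁ (x , refl) = ⊥-elim (i∉V (vertex∈Vset x))
  ... | inj₂ i≡edgeVertex = i≡edgeVertex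

  Exchange : Subset (RV G) → Set
  Exchange D = Σ[ D′ ∈ Subset (RV G) ] IsDifferential (Radj G) D′ × ∣ D′ ∣ ≡ ∣ D ∣ ×
                                        ∣ D′ ∩ ∁ (Vset G) ∣ < ∣ D ∩ ∁ (Vset G) ∣

  module _ {D : Subset (RV G)} (D-diff : IsDifferential (Radj G) D)
           (e : Fin (numEdges G)) (v∈D : edgeVertex e ∈ D) where

    private
      x₀ = proj₁ (ends e)
      y₀ = proj₂ (ends e)

      exchange-with : ∀ {x y} → x ∉ D → x ∈ Vset G → T (Radj G x (edgeVertex e)) → T (Radj G x y) →
                      (∀ {w} → T (Radj G (edgeVertex e) w) → w ≡ x ⊎ w ≡ y) → Exchange D
      exchange-with {x} x∉D x∈V axv axy N[v]⊆xy =
        replace D (edgeVertex e) x ,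
        (λ S → ℤ.≤-trans (D-diff S) (∂-replace (Radj G) v∈D x∉D axv N[v]⊆N[x])) ,
        ∣replace∣≡∣p∣ v∈D x∉D ,
        ∣replace∩q∣<∣p∩q∣ v∈D (x∉p⇒x∈∁p (edgeVertex∉Vset e)) (x∈p⇒x∉∁p x∈V)
        where
        N[v]⊆N[x] : ∀ {w} → T (Radj G (edgeVertex e) w) → w ≡ x ⊎ T (Radj G x w)
        N[v]⊆N[x] avw = Sum.map₂ (λ { refl → axy }) (N[v]⊆xy avw)

    edgeVertex-exchange : Exchange D
    edgeVertex-exchange with vertex x₀ ∈? D | vertex y₀ ∈? D
    ... | yes x∈D | yes y∈D = ⊥-elim (neighbourhood⊈differential (Radj G) D-diff v∈D λ avw →
            [ (λ { refl → x∈D }) , (λ { refl → y∈D }) ]′ (edgeVertex-neighbours e avw))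
    ... | no x∉D | _ = exchange-with x∉D (vertex∈Vset x₀)
            (subst T (sym (Radj-vertex-edgeVertex x₀ e)) (endpoint-proj₁ e))
            (subst T (sym (Radj-vertex-vertex x₀ y₀)) (ends-adjacent e))
            (edgeVertex-neighbours e)
    ... | yes _ | no y∉D = exchange-with y∉D (vertex∈Vset y₀)
            (subst T (sym (Radj-vertex-edgeVertex y₀ e)) (endpoint-proj₂ e))
            (subst T (sym (trans (Radj-vertex-vertex y₀ x₀) (symm G y₀ x₀))) (ends-adjacent e))
            (Sum.swap ∘ edgeVertex-neighbours e)

  differential-within-Vset : ∀ D → IsDifferential (Radj G) D → Acc _<_ ∣ D ∩ ∁ (Vset G) ∣ →
    Σ[ S ∈ Subset (RV G) ] S ⊆ Vset G × IsDifferential (Radj G) S × ∣ S ∣ ≡ ∣ D ∣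
  differential-within-Vset D D-diff (acc smaller) with nonempty? (D ∩ ∁ (Vset G))
  ... | no no-edgeVertex =
    D , (λ i∈D → x∉∁p⇒x∈p λ i∈∁V → no-edgeVertex (_ , x∈p∩q⁺ (i∈D , i∈∁V))) , D-diff , refl
  ... | yes (_ , i∈D∩∁V) with x∈p∩q⁻ D _ i∈D∩∁V
  ...   | i∈D , i∈∁V with ∉Vset⇒edgeVertex (x∈∁p⇒x∉p i∈∁V)
  ...     | e , refl with edgeVertex-exchange D-diff e i∈D
  ...       | D′ , D′-diff , ∣D′∣≡∣D∣ , fewer with differential-within-Vset D′ D′-diff (smaller fewer)
  ...         | S , S⊆V , S-diff , ∣S∣≡∣D′∣ = S , S⊆V , S-diff , trans ∣S∣≡∣D′∣ ∣D′∣≡∣D∣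

proposition2p3 : (n : ℕ) → n ≥ 3 → (G : SimpleGraph n) → Connected G →
    (D : Subset (RV G)) → IsDifferential (Radj G) D →
    Σ (Subset (RV G)) (λ S → S ⊆ Vset G × IsDifferential (Radj G) S × ∣ S ∣ ≡ ∣ D ∣)
proposition2p3 _ _ G _ D D-diff = differential-within-Vset G D D-diff (<-wellFounded _)
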